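{- Every deterministic stateless LCA algorithm requires $\Omega(n)$ probes to compute a leader in the Two-path leader-election problem.
   Context: Two-path leader-election problem: the input is a graph $G=(V,E)$ with $n=|V|\ge 6$ nodes and identifier set $\{1,\dots,n\}$, consisting of two vertex-disjoint paths $p_i=(v^i_1,v^i_2,v^i_3)$, $i\in\{1,2\}$, and all remaining vertices of degree zero. The required local output is $1$ at exactly one vertex of $\{v^1_2,v^2_2\}$ and $0$ at all other vertices. LCA model: a deterministic algorithm with probe access to an oracle that, given a node identifier, returns the identifiers of its neighbours; on each query node it returns that node's output, and the outputs over all queries must form a valid solution. Probe complexity is the maximum number of probes per query. Stateless means the algorithm keeps no memory between queries (space complexity zero), so each answer depends only on the query and the graph. -}

module Defs where

open import Data.Nat using (ℕ; zero; suc)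
open import Data.Bool using (Bool; true; false; _∧_; _∨_; _xor_)
open import Data.Fin using (Fin; _≟_)
open import Data.Fin.Subset using (Subset)
open import Data.Vec using (tabulate)
open import Relation.Nullary.Decidable using (⌊_⌋)
open import Relation.Nullary using (¬_)
open import Relation.Binary.PropositionalEquality using (_≡_)

-- Identifiers {1,…,n} are represented by Fin n.
-- The probe oracle answers a probe at node v with the set of identifiers of
-- v's neighbours (a Subset n = Vec Bool n).
Graph : ℕ → Set
Graph n = Fin n → Subset n

-- An instance of Two-path leader election: two vertex-disjoint paths
-- (a₁,a₂,a₃) and (b₁,b₂,b₃), all other vertices isolated.
record TwoPath (n : ℕ) : Set where
  field
    a₁ a₂ a₃ b₁ b₂ b₃ : Fin n
    a₁≢a₂ : ¬ a₁ ≡ a₂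
    a₁≢a₃ : ¬ a₁ ≡ a₃
    a₁≢b₁ : ¬ a₁ ≡ b₁
    a₁≢b₂ : ¬ a₁ ≡ b₂
    a₁≢b₃ : ¬ a₁ ≡ b₃
    a₂≢a₃ : ¬ a₂ ≡ a₃
    a₂≢b₁ : ¬ a₂ ≡ b₁
    a₂≢b₂ : ¬ a₂ ≡ b₂
    a₂≢b₃ : ¬ a₂ ≡ b₃
    a₃≢b₁ : ¬ a₃ ≡ b₁
    a₃≢b₂ : ¬ a₃ ≡ b₂
    a₃≢b₃ : ¬ a₃ ≡ b₃
    b₁≢b₂ : ¬ b₁ ≡ b₂
    b₁≢b₃ : ¬ b₁ ≡ b₃
    b₂≢b₃ : ¬ b₂ ≡ b₃

module _ {n : ℕ} (I : TwoPath n) where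
  open TwoPath I

  private
    _==_ : Fin n → Fin n → Bool
    x == y = ⌊ x ≟ y ⌋

    pathEdge : Fin n → Fin n → Fin n → Fin n → Fin n → Bool
    pathEdge x y z u w =
      ((u == x) ∧ (w == y)) ∨ ((u == y) ∧ ((w == x) ∨ (w == z))) ∨ ((u == z) ∧ (w == y))

  adj : Fin n → Fin n → Bool
  adj u w = pathEdge a₁ a₂ a₃ u w ∨ pathEdge b₁ b₂ b₃ u w

  graphOf : Graph n
  graphOf u = tabulate (adj u)

  ValidOutput : (Fin n → Bool) → Set
  ValidOutput out =
    ((out a₂ xor out b₂) ≡ true) ×' (∀ v → ¬ v ≡ a₂ → ¬ v ≡ b₂ → out v ≡ false)
    where
    open import Data.Product using () renaming (_×_ to _×'_)

-- Deterministic adaptive probing strategy for one query (a decision tree):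
-- either output a bit, or probe a node and continue depending on the answer.
data ProbeTree (n : ℕ) : Set where
  output : Bool → ProbeTree n
  probe  : Fin n → (Subset n → ProbeTree n) → ProbeTree n

-- A deterministic stateless LCA: for every query node, a probing strategy
-- (depending only on the query; the answer then depends only on query and graph).
LCA : ℕ → Set
LCA n = Fin n → ProbeTree n

run : {n : ℕ} → ProbeTree n → Graph n → Bool
run (output b) G = b
run (probe v k) G = run (k (G v)) G

probes : {n : ℕ} → ProbeTree n → Graph n → ℕ
probes (output b) G = 0
probes (probe v k) G = suc (probes (k (G v)) G)

Solves : {n : ℕ} → LCA n → Set
Solves {n} A = (I : TwoPath n) → ValidOutput I (λ v → run (A v) (graphOf I))

module Submission where

-- Cut the identifiers into k = 4(p+1) disjoint blocks of three nodes and let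
-- pathGraph i be the graph consisting of the path on block i alone.  Let the
-- query at the middle node of block i run on pathGraph i; its probes "hit" a
-- block j if some probed node lies in block j.  On the legal instance formed
-- by the paths of blocks i and j the query behaves exactly as on pathGraph i
-- as long as it does not hit block j.
--  * If some such query makes more than p probes, its first p+1 probes hit at
--    most p+1 blocks, so some block j ≠ i is missed and on instance (i,j) the
--    query at the middle of block i still makes more than p probes.
--  * Otherwise the hit relation is a digraph of out-degree ≤ p.  One of the
--    two possible answers is given by at least 2p+2 blocks, and a digraph of
--    out-degree ≤ p on 2p+2 vertices has a non-adjacent pair i, j (a vertex of
--    in-degree ≤ p exists by double counting).  On instance (i,j) both middle
--    nodes give the same answer, contradicting validity.

open import Defs
open import Data.Nat using (ℕ; zero; suc; _+_; _*_; _≤_; _<_; _≤?_; z≤n; s≤s)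
open import Data.Nat.Properties hiding (_≟_)
open import Algebra.Properties.CommutativeSemigroup +-commutativeSemigroup using (interchange)
open import Data.Nat.DivMod using (_/_; _%_; m/n*n≤m; m≥n⇒m/n>0; m≡m%n+[m/n]*n; m%n<n)
open import Data.Nat.Tactic.RingSolver using (solve-∀)
open import Data.Bool using (Bool; true; false; _∧_; _∨_; _xor_)
open import Data.Bool.ListAction using (any)
open import Data.Bool.Properties using (xor-same; ∨-identityʳ) renaming (_≟_ to _≟ᵇ_)
open import Data.Fin using (Fin; combine; inject≤; _≟_)
open import Data.Fin.Patterns using (0F; 1F; 2F)
open import Data.Fin.Properties using (any?; combine-injective; inject≤-injective)
open import Data.List using (List; []; _∷_; length; take; filter; allFin)
open import Data.List.Properties using (length-take; length-tabulate)
open import Data.List.Membership.Propositional using (_∈_)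
open import Data.List.Membership.Propositional.Properties using (∈-filter⁻)
open import Data.List.Relation.Unary.All using (All; []; _∷_)
import Data.List.Relation.Unary.All as All
open import Data.List.Relation.Unary.Any using (here; there)
open import Data.List.Relation.Unary.Unique.Propositional using (Unique)
open import Data.List.Relation.Unary.Unique.Propositional.Properties using (allFin⁺; filter⁺)
open import Data.List.Relation.Unary.AllPairs using (_∷_)
open import Data.Product using (Σ; _×_; _,_; proj₁; proj₂)
open import Data.Empty using (⊥; ⊥-elim)
open import Data.Vec using (tabulate)
open import Data.Vec.Properties using (tabulate-cong)
open import Function using (_∘_)
open import Relation.Nullary using (¬_; Dec; yes; no)
open import Relation.Nullary.Decidable using (⌊_⌋)
open import Relation.Binary.Definitions using (DecidableEquality)
open import Relation.Binary.PropositionalEquality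

∑ : {A : Set} → List A → (A → ℕ) → ℕ
∑ []      f = 0
∑ (x ∷ L) f = f x + ∑ L f

syntax ∑ L (λ x → e) = ∑[ x ∈ L ] e

∑-mono : {A : Set} (L : List A) {f g : A → ℕ} → (∀ {x} → x ∈ L → f x ≤ g x) → ∑ L f ≤ ∑ L g
∑-mono []      le = z≤n
∑-mono (x ∷ L) le = +-mono-≤ (le (here refl)) (∑-mono L (le ∘ there))

∑-+ : {A : Set} (L : List A) (f g : A → ℕ) → ∑[ x ∈ L ] (f x + g x) ≡ ∑ L f + ∑ L g
∑-+ []      f g = refl
∑-+ (x ∷ L) f g = begin
  f x + g x + ∑[ y ∈ L ] (f y + g y)  ≡⟨ cong (f x + g x +_) (∑-+ L f g) ⟩
  f x + g x + (∑ L f + ∑ L g)         ≡⟨ interchange (f x) (g x) (∑ L f) (∑ L g) ⟩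
  f x + ∑ L f + (g x + ∑ L g)         ∎
  where open ≡-Reasoning

∑-const : {A : Set} (L : List A) (c : ℕ) → ∑ L (λ _ → c) ≡ length L * c
∑-const []      c = refl
∑-const (x ∷ L) c = cong (c +_) (∑-const L c)

∑-zero : {A : Set} (L : List A) → ∑ L (λ _ → 0) ≡ 0
∑-zero L = trans (∑-const L 0) (*-zeroʳ (length L))

∑-swap : {A B : Set} (L : List A) (M : List B) (f : A → B → ℕ) →
         ∑[ x ∈ L ] ∑[ y ∈ M ] f x y ≡ ∑[ y ∈ M ] ∑[ x ∈ L ] f x y
∑-swap []      M f = sym (∑-zero M)
∑-swap (x ∷ L) M f = begin
  ∑ M (f x) + ∑[ x′ ∈ L ] ∑[ y ∈ M ] f x′ y  ≡⟨ cong (∑ M (f x) +_) (∑-swap L M f) ⟩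
  ∑ M (f x) + ∑[ y ∈ M ] ∑[ x′ ∈ L ] f x′ y  ≡⟨ ∑-+ M (f x) (λ y → ∑[ x′ ∈ L ] f x′ y) ⟨
  ∑[ y ∈ M ] (f x y + ∑[ x′ ∈ L ] f x′ y)    ∎
  where open ≡-Reasoning

below-average : {A : Set} (L : List A) (f : A → ℕ) (m : ℕ) →
                ∑ L f < length L * suc m → Σ A λ x → x ∈ L × f x ≤ m
below-average []      f m ()
below-average (x ∷ L) f m total with f x ≤? m
... | yes fx≤m = x , here refl , fx≤m
... | no  fx≰m =
  let (y , y∈L , fy≤m) = below-average L f m rest in y , there y∈L , fy≤m
  where
  -- the head exceeds m, so the tail alone stays below |tail|·(m+1)
  rest : ∑ L f < length L * suc m
  rest = +-cancelˡ-< (suc m) _ _ (≤-<-trans (+-monoˡ-≤ (∑ L f) (≰⇒> fx≰m)) total)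

ind : Bool → ℕ
ind true  = 1
ind false = 0

ind-∨ : ∀ a b → ind (a ∨ b) ≤ ind a + ind b
ind-∨ true  b = s≤s z≤n
ind-∨ false b = ≤-refl

∨-false : ∀ {a b} → a ∨ b ≡ false → a ≡ false × b ≡ false
∨-false {false} b≡false = refl , b≡false

dec-true : {P : Set} (d : Dec P) → ⌊ d ⌋ ≡ true → P
dec-true (yes p) _ = p

dec-false : {P : Set} (d : Dec P) → ⌊ d ⌋ ≡ false → ¬ P
dec-false (no ¬p) _ = ¬p

some-false : {A : Set} (L : List A) (h : A → Bool) →
             ∑[ x ∈ L ] ind (h x) < length L → Σ A λ x → x ∈ L × h x ≡ false
some-false L h few =
  let (x , x∈L , hx≤0) = below-average L (ind ∘ h) 0 (subst (∑ L (ind ∘ h) <_) (sym (*-identityʳ (length L))) few)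
  in  x , x∈L , ind≤0 (h x) hx≤0
  where
  ind≤0 : ∀ b → ind b ≤ 0 → b ≡ false
  ind≤0 false _ = refl

count-functional : {A : Set} (h : A → Bool) (L : List A) → Unique L →
                   (∀ {x y} → h x ≡ true → h y ≡ true → x ≡ y) → ∑[ x ∈ L ] ind (h x) ≤ 1
count-functional h []      _            _   = z≤n
count-functional h (x ∷ L) (x∉L ∷ uniq) fun with h x in hx
... | false = count-functional h L uniq fun
... | true  = s≤s (≤-trans (∑-mono L only-x) (≤-reflexive (∑-zero L)))
  where
  only-x : ∀ {y} → y ∈ L → ind (h y) ≤ 0
  only-x {y} y∈L with h y in hy
  ... | false = z≤n
  ... | true  = ⊥-elim (All.lookup x∉L y∈L (fun hx hy))

module _ {A : Set} (_≟ᴬ_ : DecidableEquality A) where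

  count-equal : (L : List A) → Unique L → (y : A) → ∑[ x ∈ L ] ind ⌊ x ≟ᴬ y ⌋ ≤ 1
  count-equal L uniq y = count-functional (λ x → ⌊ x ≟ᴬ y ⌋) L uniq
    (λ {x} {x′} x≡y x′≡y → trans (dec-true (x ≟ᴬ y) x≡y) (sym (dec-true (x′ ≟ᴬ y) x′≡y)))

  -- A digraph (given by R) of out-degree ≤ p on at least 2p+2 vertices has two
  -- distinct vertices with no edge between them in either direction: by double
  -- counting some j has in-degree ≤ p, and at most 2p+1 vertices are adjacent
  -- to or equal to j.
  sparse-pair : (R : A → A → Bool) (p : ℕ) (C : List A) → Unique C →
                (∀ i → ∑[ j ∈ C ] ind (R i j) ≤ p) → 2 * p + 2 ≤ length C →
                Σ A λ i → Σ A λ j → i ∈ C × j ∈ C × ¬ i ≡ j × R i j ≡ false × R j i ≡ false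
  sparse-pair R p C uniq outdeg large =
    let (j , j∈C , indeg-j)     = below-average C indegree p edges
        (i , i∈C , unblocked)   = some-false C (blocked j) (few-blocked j indeg-j)
        (adjacent , i≠j)        = ∨-false unblocked
        (Rij , Rji)             = ∨-false adjacent
    in  i , j , i∈C , j∈C , dec-false (i ≟ᴬ j) i≠j , Rij , Rji
    where
    open ≤-Reasoning
    indegree : A → ℕ
    indegree j = ∑[ i ∈ C ] ind (R i j)

    nonempty : 0 < length C
    nonempty = ≤-trans (s≤s z≤n) (≤-trans (m≤n+m 2 (2 * p)) large)

    edges : ∑[ j ∈ C ] indegree j < length C * suc p
    edges = begin-strict
      ∑[ j ∈ C ] ∑[ i ∈ C ] ind (R i j)  ≡⟨ ∑-swap C C (λ i j → ind (R i j)) ⟨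
      ∑[ i ∈ C ] ∑[ j ∈ C ] ind (R i j)  ≤⟨ ∑-mono C (λ {i} _ → outdeg i) ⟩
      ∑ C (λ _ → p)                      ≡⟨ ∑-const C p ⟩
      length C * p                       <⟨ m<n+m (length C * p) nonempty ⟩
      length C + length C * p            ≡⟨ *-suc (length C) p ⟨
      length C * suc p                   ∎

    blocked : A → A → Bool
    blocked j i = (R i j ∨ R j i) ∨ ⌊ i ≟ᴬ j ⌋

    few-blocked : ∀ j → indegree j ≤ p → ∑[ i ∈ C ] ind (blocked j i) < length C
    few-blocked j indeg-j = begin-strict
      ∑[ i ∈ C ] ind (blocked j i)
        ≤⟨ ∑-mono C (λ {i} _ → ≤-trans (ind-∨ (R i j ∨ R j i) _) (+-monoˡ-≤ _ (ind-∨ (R i j) (R j i)))) ⟩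
      ∑[ i ∈ C ] (ind (R i j) + ind (R j i) + ind ⌊ i ≟ᴬ j ⌋)
        ≡⟨ ∑-+ C (λ i → ind (R i j) + ind (R j i)) (λ i → ind ⌊ i ≟ᴬ j ⌋) ⟩
      ∑[ i ∈ C ] (ind (R i j) + ind (R j i)) + ∑[ i ∈ C ] ind ⌊ i ≟ᴬ j ⌋
        ≡⟨ cong (_+ ∑[ i ∈ C ] ind ⌊ i ≟ᴬ j ⌋) (∑-+ C (λ i → ind (R i j)) (λ i → ind (R j i))) ⟩
      indegree j + ∑[ i ∈ C ] ind (R j i) + ∑[ i ∈ C ] ind ⌊ i ≟ᴬ j ⌋
        ≤⟨ +-mono-≤ (+-mono-≤ indeg-j (outdeg j)) (count-equal C uniq j) ⟩
      p + p + 1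
        <⟨ ≤-reflexive (double p) ⟩
      2 * p + 2
        ≤⟨ large ⟩
      length C ∎
      where
      double : ∀ p → suc (p + p + 1) ≡ 2 * p + 2
      double = solve-∀

filter-split : {A : Set} (f : A → Bool) (L : List A) →
  length (filter (λ x → f x ≟ᵇ true) L) + length (filter (λ x → f x ≟ᵇ false) L) ≡ length L
filter-split f []      = refl
filter-split f (x ∷ L) with f x
... | true  = cong suc (filter-split f L)
... | false = trans (+-suc _ _) (cong suc (filter-split f L))

majority : {A : Set} (f : A → Bool) (L : List A) (m : ℕ) → m + m ≤ length L →
           Σ Bool λ c → m ≤ length (filter (λ x → f x ≟ᵇ c) L)
majority f L m big with m ≤? length (filter (λ x → f x ≟ᵇ true) L)
... | yes enough = true , enough
... | no  few    = false , +-cancelˡ-≤ m m _ (begin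
      m + m                                                    ≤⟨ big ⟩
      length L                                                 ≡⟨ filter-split f L ⟨
      length (filter _ L) + length (filter (λ x → f x ≟ᵇ false) L)
        ≤⟨ +-monoˡ-≤ _ (<⇒≤ (≰⇒> few)) ⟩
      m + length (filter (λ x → f x ≟ᵇ false) L)               ∎)
  where open ≤-Reasoning

hits : {B A : Set} → (B → A → Bool) → List B → A → Bool
hits R S j = any (λ u → R u j) S

hits-false : {B A : Set} (R : B → A → Bool) (S : List B) (j : A) →
             hits R S j ≡ false → All (λ u → R u j ≡ false) S
hits-false R []      j _ = []
hits-false R (u ∷ S) j missed with R u j in Ruj
... | false = Ruj ∷ hits-false R S j missed

hits-count : {B A : Set} (R : B → A → Bool) (S : List B) (L : List A) →
             (∀ u → ∑[ j ∈ L ] ind (R u j) ≤ 1) → ∑[ j ∈ L ] ind (hits R S j) ≤ length S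
hits-count R []      L one = ≤-reflexive (∑-zero L)
hits-count R (u ∷ S) L one = begin
  ∑[ j ∈ L ] ind (R u j ∨ hits R S j)                  ≤⟨ ∑-mono L (λ {j} _ → ind-∨ (R u j) (hits R S j)) ⟩
  ∑[ j ∈ L ] (ind (R u j) + ind (hits R S j))          ≡⟨ ∑-+ L (λ j → ind (R u j)) (λ j → ind (hits R S j)) ⟩
  ∑[ j ∈ L ] ind (R u j) + ∑[ j ∈ L ] ind (hits R S j) ≤⟨ +-mono-≤ (one u) (hits-count R S L one) ⟩
  suc (length S)                                       ∎
  where open ≤-Reasoning

trace : {n : ℕ} → ProbeTree n → Graph n → List (Fin n)
trace (output b)  G = []
trace (probe v k) G = v ∷ trace (k (G v)) G

run-agree : {n : ℕ} (t : ProbeTree n) {G G′ : Graph n} →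
            All (λ u → G u ≡ G′ u) (trace t G) → run t G ≡ run t G′
run-agree (output b)  _        = refl
run-agree (probe v k) (e ∷ es) rewrite sym e = run-agree (k _) es

probes-agree : {n : ℕ} (q : ℕ) (t : ProbeTree n) {G G′ : Graph n} →
               All (λ u → G u ≡ G′ u) (take q (trace t G)) → q ≤ length (trace t G) → q ≤ probes t G′
probes-agree zero    _           _        _          = z≤n
probes-agree (suc q) (probe v k) (e ∷ es) (s≤s long) rewrite sym e = s≤s (probes-agree q (k _) es long)

pathAdj : {n : ℕ} → Fin n → Fin n → Fin n → Fin n → Fin n → Bool
pathAdj x y z u w =
  (⌊ u ≟ x ⌋ ∧ ⌊ w ≟ y ⌋) ∨ (⌊ u ≟ y ⌋ ∧ (⌊ w ≟ x ⌋ ∨ ⌊ w ≟ z ⌋)) ∨ (⌊ u ≟ z ⌋ ∧ ⌊ w ≟ y ⌋)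

pathAdj-outside : {n : ℕ} {x y z u : Fin n} (w : Fin n) →
                  ¬ u ≡ x → ¬ u ≡ y → ¬ u ≡ z → pathAdj x y z u w ≡ false
pathAdj-outside {x = x} {y} {z} {u} w u≢x u≢y u≢z with u ≟ x | u ≟ y | u ≟ z
... | yes u≡x | _       | _       = ⊥-elim (u≢x u≡x)
... | no _    | yes u≡y | _       = ⊥-elim (u≢y u≡y)
... | no _    | no _    | yes u≡z = ⊥-elim (u≢z u≡z)
... | no _    | no _    | no _    = refl

-- The first 3k identifiers, split into k blocks of three consecutive nodes.
module Blocks {n k : ℕ} (room : k * 3 ≤ n) where

  node : Fin k → Fin 3 → Fin n
  node i a = inject≤ (combine i a) room

  node-injective : ∀ {i j a b} → node i a ≡ node j b → i ≡ j × a ≡ b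
  node-injective {i} {j} {a} {b} e = combine-injective i a j b (inject≤-injective room room _ _ e)

  apart-blocks : ∀ {i j a b} → ¬ i ≡ j → ¬ node i a ≡ node j b
  apart-blocks i≢j = i≢j ∘ proj₁ ∘ node-injective

  apart-slots : ∀ {i a b} → ¬ a ≡ b → ¬ node i a ≡ node i b
  apart-slots a≢b = a≢b ∘ proj₂ ∘ node-injective

  inBlock : Fin n → Fin k → Bool
  inBlock u j = ⌊ any? (λ a → u ≟ node j a) ⌋

  inBlock-unique : (u : Fin n) (L : List (Fin k)) → Unique L → ∑[ j ∈ L ] ind (inBlock u j) ≤ 1
  inBlock-unique u L uniq = count-functional (inBlock u) L uniq λ {j} {j′} inj inj′ →
    let (a , u≡a) = dec-true (any? (λ a → u ≟ node j a)) inj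
        (b , u≡b) = dec-true (any? (λ b → u ≟ node j′ b)) inj′
    in proj₁ (node-injective (trans (sym u≡a) u≡b))

  outside : ∀ {u j} → inBlock u j ≡ false → ∀ a → ¬ u ≡ node j a
  outside {u} {j} notIn a u≡ = dec-false (any? (λ a → u ≟ node j a)) notIn (a , u≡)

  path : Fin k → Fin n → Fin n → Bool
  path i = pathAdj (node i 0F) (node i 1F) (node i 2F)

  path-outside : ∀ {u} i → inBlock u i ≡ false → ∀ w → path i u w ≡ false
  path-outside i notIn w = pathAdj-outside w (outside notIn 0F) (outside notIn 1F) (outside notIn 2F)

  -- The graph consisting of the path on block i only (not itself an instance).
  pathGraph : Fin k → Graph n
  pathGraph i u = tabulate (path i u)

  twoPaths : (i j : Fin k) → ¬ i ≡ j → TwoPath n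
  twoPaths i j i≢j = record
    { a₁ = node i 0F ; a₂ = node i 1F ; a₃ = node i 2F
    ; b₁ = node j 0F ; b₂ = node j 1F ; b₃ = node j 2F
    ; a₁≢a₂ = apart-slots λ () ; a₁≢a₃ = apart-slots λ () ; a₂≢a₃ = apart-slots λ ()
    ; b₁≢b₂ = apart-slots λ () ; b₁≢b₃ = apart-slots λ () ; b₂≢b₃ = apart-slots λ ()
    ; a₁≢b₁ = apart-blocks i≢j ; a₁≢b₂ = apart-blocks i≢j ; a₁≢b₃ = apart-blocks i≢j
    ; a₂≢b₁ = apart-blocks i≢j ; a₂≢b₂ = apart-blocks i≢j ; a₂≢b₃ = apart-blocks i≢j
    ; a₃≢b₁ = apart-blocks i≢j ; a₃≢b₂ = apart-blocks i≢j ; a₃≢b₃ = apart-blocks i≢j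
    }

  agree-left : ∀ i j (i≢j : ¬ i ≡ j) {u} → inBlock u j ≡ false → pathGraph i u ≡ graphOf (twoPaths i j i≢j) u
  agree-left i j i≢j {u} notIn = tabulate-cong λ w →
    sym (trans (cong (path i u w ∨_) (path-outside j notIn w)) (∨-identityʳ _))

  agree-right : ∀ i j (i≢j : ¬ i ≡ j) {u} → inBlock u i ≡ false → pathGraph j u ≡ graphOf (twoPaths i j i≢j) u
  agree-right i j i≢j {u} notIn = tabulate-cong λ w → sym (cong (_∨ path j u w) (path-outside i notIn w))

  missed-block : (i : Fin k) (S : List (Fin n)) → length S + 1 < k →
                 Σ (Fin k) λ j → ¬ i ≡ j × hits inBlock S j ≡ false
  missed-block i S short =
    let (j , _ , free)    = some-false (allFin k) blocked few-blocked
        (unhit , j≠i)     = ∨-false free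
    in  j , ≢-sym (dec-false (j ≟ i) j≠i) , unhit
    where
    open ≤-Reasoning
    blocked : Fin k → Bool
    blocked j = hits inBlock S j ∨ ⌊ j ≟ i ⌋
    few-blocked : ∑[ j ∈ allFin k ] ind (blocked j) < length (allFin k)
    few-blocked = begin-strict
      ∑[ j ∈ allFin k ] ind (blocked j)
        ≤⟨ ∑-mono (allFin k) (λ {j} _ → ind-∨ (hits inBlock S j) ⌊ j ≟ i ⌋) ⟩
      ∑[ j ∈ allFin k ] (ind (hits inBlock S j) + ind ⌊ j ≟ i ⌋)
        ≡⟨ ∑-+ (allFin k) (λ j → ind (hits inBlock S j)) (λ j → ind ⌊ j ≟ i ⌋) ⟩
      ∑[ j ∈ allFin k ] ind (hits inBlock S j) + ∑[ j ∈ allFin k ] ind ⌊ j ≟ i ⌋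
        ≤⟨ +-mono-≤ (hits-count inBlock S (allFin k) (λ u → inBlock-unique u (allFin k) (allFin⁺ k)))
                    (count-equal _≟_ (allFin k) (allFin⁺ k) i) ⟩
      length S + 1
        <⟨ short ⟩
      k
        ≡⟨ length-tabulate {n = k} (λ j → j) ⟨
      length (allFin k) ∎

module LowerBound (n p : ℕ) (room : 4 * suc p * 3 ≤ n) (A : LCA n) (solves : Solves A) where

  k : ℕ
  k = 4 * suc p

  open Blocks {n} {k} room

  mid : Fin k → Fin n
  mid i = node i 1F

  probed : Fin k → List (Fin n)
  probed i = trace (A (mid i)) (pathGraph i)

  answer : Fin k → Bool
  answer i = run (A (mid i)) (pathGraph i)

  hit : Fin k → Fin k → Bool
  hit i = hits inBlock (probed i)

  answer-left : ∀ i j (i≢j : ¬ i ≡ j) → hit i j ≡ false →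
                answer i ≡ run (A (mid i)) (graphOf (twoPaths i j i≢j))
  answer-left i j i≢j missed =
    run-agree (A (mid i)) (All.map (agree-left i j i≢j) (hits-false inBlock (probed i) j missed))

  answer-right : ∀ i j (i≢j : ¬ i ≡ j) → hit j i ≡ false →
                 answer j ≡ run (A (mid j)) (graphOf (twoPaths i j i≢j))
  answer-right i j i≢j missed =
    run-agree (A (mid j)) (All.map (agree-right i j i≢j) (hits-false inBlock (probed j) i missed))

  Witness : Set
  Witness = Σ (TwoPath n) λ I → Σ (Fin n) λ v → suc p ≤ probes (A v) (graphOf I)

  -- A long probe sequence survives on an instance whose second path its first p+1 probes miss.
  long-probing : ∀ i → suc p ≤ length (probed i) → Witness
  long-probing i long =
    let (j , i≢j , missed) = missed-block i S short
    in  twoPaths i j i≢j , mid i ,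
        probes-agree (suc p) (A (mid i)) (All.map (agree-left i j i≢j) (hits-false inBlock S j missed)) long
    where
    S = take (suc p) (probed i)
    short : length S + 1 < k
    short = begin-strict
      length S + 1                  ≤⟨ +-monoˡ-≤ 1 (≤-trans (≤-reflexive (length-take (suc p) (probed i))) (m⊓n≤m _ _)) ⟩
      suc p + 1                     <⟨ m≤m+n (suc (suc p + 1)) (3 * p + 1) ⟩
      suc (suc p + 1) + (3 * p + 1) ≡⟨ blocks p ⟩
      k                             ∎
      where
      open ≤-Reasoning
      blocks : ∀ p → suc (suc p + 1) + (3 * p + 1) ≡ 4 * suc p
      blocks = solve-∀

  conflict : ∀ i j (i≢j : ¬ i ≡ j) → hit i j ≡ false → hit j i ≡ false → answer i ≡ answer j → ⊥
  conflict i j i≢j hij hji same = false≢true (begin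
    false                  ≡⟨ xor-same (answer i) ⟨
    answer i xor answer i  ≡⟨ cong (answer i xor_) same ⟩
    answer i xor answer j  ≡⟨ cong₂ _xor_ (answer-left i j i≢j hij) (answer-right i j i≢j hji) ⟩
    run (A (mid i)) (graphOf (twoPaths i j i≢j)) xor run (A (mid j)) (graphOf (twoPaths i j i≢j))
                           ≡⟨ proj₁ (solves (twoPaths i j i≢j)) ⟩
    true                   ∎)
    where
    open ≡-Reasoning
    false≢true : ¬ false ≡ true
    false≢true ()

  colourClass : Bool → List (Fin k)
  colourClass c = filter (λ x → answer x ≟ᵇ c) (allFin k)

  large-class : Σ Bool λ c → 2 * p + 2 ≤ length (colourClass c)
  large-class = majority answer (allFin k) (2 * p + 2)
    (≤-reflexive (trans (halves p) (sym (length-tabulate {n = k} (λ j → j)))))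
    where
    halves : ∀ p → (2 * p + 2) + (2 * p + 2) ≡ 4 * suc p
    halves = solve-∀

  -- If every such query makes at most p probes, a sparse pair in a large colour class gives a conflict.
  short-probing : (∀ i → length (probed i) ≤ p) → ⊥
  short-probing short =
    let (i , j , i∈C , j∈C , i≢j , hij , hji) = sparse-pair _≟_ hit p C uniq outdeg (proj₂ large-class)
    in  conflict i j i≢j hij hji (trans (coloured i∈C) (sym (coloured j∈C)))
    where
    c = proj₁ large-class
    C = colourClass c
    uniq : Unique C
    uniq = filter⁺ (λ x → answer x ≟ᵇ c) (allFin⁺ k)
    outdeg : ∀ i → ∑[ j ∈ C ] ind (hit i j) ≤ p
    outdeg i = ≤-trans (hits-count inBlock (probed i) C (λ u → inBlock-unique u C uniq)) (short i)
    coloured : ∀ {i} → i ∈ C → answer i ≡ c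
    coloured i∈C = proj₂ (∈-filter⁻ (λ x → answer x ≟ᵇ c) i∈C)

  lower-bound : Witness
  lower-bound with any? (λ i → suc p ≤? length (probed i))
  ... | yes (i , long) = long-probing i long
  ... | no  noLong     = ⊥-elim (short-probing λ i → ≮⇒≥ (λ long → noLong (i , long)))

-- Choosing p + 1 = ⌊n/12⌋ for n ≥ 12: the 4(p+1) blocks of three fit, and n < 12(p+2) ≤ 24(p+1).
block-parameter : ∀ n → 12 ≤ n → Σ ℕ λ p → 4 * suc p * 3 ≤ n × (∀ x → suc p ≤ x → n ≤ 24 * x)
block-parameter n 12≤n with n / 12 in q≡ | m≥n⇒m/n>0 {n} {12} 12≤n
... | suc p | _ = p , fits , bound
  where
  open ≤-Reasoning
  fits : 4 * suc p * 3 ≤ n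
  fits = begin
    4 * suc p * 3  ≡⟨ twelve p ⟩
    suc p * 12     ≡⟨ cong (_* 12) q≡ ⟨
    n / 12 * 12    ≤⟨ m/n*n≤m n 12 ⟩
    n              ∎
    where
    twelve : ∀ p → 4 * suc p * 3 ≡ suc p * 12
    twelve = solve-∀
  bound : ∀ x → suc p ≤ x → n ≤ 24 * x
  bound x p<x = <⇒≤ (begin-strict
    n                        ≡⟨ m≡m%n+[m/n]*n n 12 ⟩
    n % 12 + n / 12 * 12     ≡⟨ cong (λ q → n % 12 + q * 12) q≡ ⟩
    n % 12 + suc p * 12      <⟨ +-monoˡ-< (suc p * 12) (m%n<n n 12) ⟩
    12 + suc p * 12          ≤⟨ m≤m+n (12 + suc p * 12) (12 * p) ⟩
    12 + suc p * 12 + 12 * p ≡⟨ twice p ⟩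
    24 * suc p               ≤⟨ *-monoʳ-≤ 24 p<x ⟩
    24 * x                   ∎)
    where
    twice : ∀ p → 12 + suc p * 12 + 12 * p ≡ 24 * suc p
    twice = solve-∀

theorem7 : Σ ℕ λ d → Σ ℕ λ N → (n : ℕ) → N ≤ n → 6 ≤ n → (A : LCA n) → Solves A →
             Σ (TwoPath n) λ I → Σ (Fin n) λ v → n ≤ d * probes (A v) (graphOf I)
theorem7 = 24 , 12 , λ n 12≤n _ A solves →
  let (p , room , bound) = block-parameter n 12≤n
      (I , v , many)     = LowerBound.lower-bound n p room A solves
  in  I , v , bound _ many
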